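{- Let $n=p_1^{n_1}p_2^{n_2}\cdots p_r^{n_r}$, where $r\geq 2$, $n_1,\ldots,n_r$ are positive integers and $p_1,\ldots,p_r$ are distinct primes with $p_1<p_2<\cdots<p_r$. For $1\leq i\leq r-1$, $$\phi\left(\frac{n}{p_i}\right)\geq \phi\left(\frac{n}{p_r^{n_r}}\right)p_r^{n_r-1},$$ and the inequality is strict except when $r=2$, $p_1=2$, $p_2=3$ and $n_1\geq 2$.
   Context: $\phi$ is Euler's totient function. -}

module Defs where

open import Data.Nat using (ℕ; zero; suc; _+_; _*_; _^_; _/_)
open import Data.Nat.GCD using (gcd)
open import Data.Nat.Primality using (Prime; prime⇒nonZero)
open import Data.Nat.Properties using (_≟_; m^n≢0)
open import Data.List using (List; length; filter; upTo; map)
open import Data.Fin using (Fin)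
open import Relation.Nullary.Decidable using (⌊_⌋)

φ : ℕ → ℕ
φ n = length (filter (λ k → gcd k n ≟ 1) (map suc (upTo n)))

∏ : (r : ℕ) → (Fin r → ℕ) → ℕ
∏ zero    f = 1
∏ (suc r) f = f Fin.zero * ∏ r (λ i → f (Fin.suc i))

divPrime : (m p : ℕ) → Prime p → ℕ
divPrime m p pp = _/_ m p {{prime⇒nonZero pp}}

divPrimePow : (m p e : ℕ) → Prime p → ℕ
divPrimePow m p e pp = _/_ m (p ^ e) {{m^n≢0 p e {{prime⇒nonZero pp}}}}

-- Write n = p_i · B · p_r^{e_r} with p_r ∤ B. Then n / p_i = B · p_r^{e_r} and
-- n / p_r^{e_r} = p_i · B, and multiplicativity of φ reduces the claim to comparing
-- φ(p_i B) with φ(p_r B) = (p_r − 1) φ(B). Now φ(p_i B) is p_i φ(B) or (p_i − 1) φ(B)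
-- according as p_i ∣ B (that is, n_i ≥ 2) or not, and p_i < p_r; equality can only
-- occur when p_i ∣ B and p_i + 1 = p_r, i.e. p_i = 2, p_r = 3, which forces r = 2.
module Submission where

open import Defs
open import Data.Bool using (Bool; true; false; _∧_; not)
open import Data.Bool.Properties using (∧-zeroʳ; ∧-identityʳ)
open import Data.Empty using (⊥-elim)
open import Data.Fin using (Fin; toℕ; inject₁; fromℕ; punchIn) renaming (zero to fzero; suc to fsuc)
open import Data.Fin.Properties using (toℕ-injective; toℕ-fromℕ; inject₁ℕ<; inject₁-injective; punchInᵢ≢i)
open import Data.List using ([]; _∷_; _++_; length; filter; upTo; map)
open import Data.List.Properties using (upTo-∷ʳ; map-++; filter-++; length-++)
open import Data.Nat
open import Data.Nat.Coprimality using (Coprime; coprime?; coprime-divisor; gcd≡1⇒coprime; coprime⇒gcd≡1)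
  renaming (sym to coprime-sym)
open import Data.Nat.Divisibility
open import Data.Nat.DivMod using (m*n/n≡m)
open import Data.Nat.GCD using (gcd)
open import Data.Nat.Primality using (Prime; prime[2]; prime⇒nonZero; prime⇒nonTrivial; prime⇒irreducible; euclidsLemma)
open import Data.Nat.Properties
open import Algebra.Properties.CommutativeSemigroup +-commutativeSemigroup using (interchange)
open import Algebra.Properties.CommutativeSemigroup *-commutativeSemigroup using (x∙yz≈y∙xz; x∙yz≈z∙yx; xy∙z≈yz∙x)
open import Data.Product using (Σ; _×_; _,_; proj₁; proj₂)
open import Data.Sum using (_⊎_; inj₁; inj₂)
open import Function using (_∘_)
open import Function.Bundles using (_⇔_; mk⇔; module Equivalence)
open import Function.Construct.Composition using (_⇔-∘_)
open import Level using (0ℓ)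
open import Relation.Binary.Definitions using (tri<; tri≈; tri>)
open import Relation.Binary.PropositionalEquality
open import Relation.Nullary using (¬_; yes; no; does; contradiction; contraposition)
open import Relation.Nullary.Decidable using (dec-true; dec-false; does-⇔)
open import Relation.Unary using (Pred; Decidable)

open ≡-Reasoning

iverson : Bool → ℕ
iverson true  = 1
iverson false = 0

count : (ℕ → Bool) → ℕ → ℕ
count f zero    = 0
count f (suc n) = count f n + iverson (f (suc n))

length-filter-upTo : {P : Pred ℕ 0ℓ} (P? : Decidable P) (n : ℕ) →
  length (filter P? (map suc (upTo n))) ≡ count (does ∘ P?) n
length-filter-upTo P? zero = refl
length-filter-upTo P? (suc n) = begin
  length (filter P? (map suc (upTo (suc n))))
    ≡⟨ cong (length ∘ filter P? ∘ map suc) (sym (upTo-∷ʳ n)) ⟩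
  length (filter P? (map suc (upTo n ++ n ∷ [])))
    ≡⟨ cong (length ∘ filter P?) (map-++ suc (upTo n) (n ∷ [])) ⟩
  length (filter P? (map suc (upTo n) ++ suc n ∷ []))
    ≡⟨ cong length (filter-++ P? (map suc (upTo n)) (suc n ∷ [])) ⟩
  length (filter P? (map suc (upTo n)) ++ filter P? (suc n ∷ []))
    ≡⟨ length-++ (filter P? (map suc (upTo n))) ⟩
  length (filter P? (map suc (upTo n))) + length (filter P? (suc n ∷ []))
    ≡⟨ cong₂ _+_ (length-filter-upTo P? n) (length-filter-[x] (suc n)) ⟩
  count (does ∘ P?) (suc n) ∎
  where
  length-filter-[x] : ∀ x → length (filter P? (x ∷ [])) ≡ iverson (does (P? x))
  length-filter-[x] x with does (P? x)
  ... | true  = refl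
  ... | false = refl

count-cong : ∀ {f g : ℕ → Bool} n → (∀ k → k < n → f (suc k) ≡ g (suc k)) → count f n ≡ count g n
count-cong zero    f≗g = refl
count-cong (suc n) f≗g =
  cong₂ _+_ (count-cong n (λ k k<n → f≗g k (m<n⇒m<1+n k<n))) (cong iverson (f≗g n ≤-refl))

count-false : ∀ n → count (λ _ → false) n ≡ 0
count-false zero    = refl
count-false (suc n) = cong (_+ 0) (count-false n)

count-+ : ∀ (f : ℕ → Bool) m n → count f (m + n) ≡ count f m + count (λ k → f (m + k)) n
count-+ f m zero rewrite +-identityʳ m = sym (+-identityʳ (count f m))
count-+ f m (suc n) rewrite +-suc m n | count-+ f m n = +-assoc (count f m) _ _

count-periodic : ∀ (f : ℕ → Bool) m → (∀ k → f (m + k) ≡ f k) → ∀ j → count f (j * m) ≡ j * count f m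
count-periodic f m f-per zero    = refl
count-periodic f m f-per (suc j) = begin
  count f (m + j * m)                          ≡⟨ count-+ f m (j * m) ⟩
  count f m + count (λ k → f (m + k)) (j * m)  ≡⟨ cong (count f m +_) (count-cong (j * m) (λ k _ → f-per (suc k))) ⟩
  count f m + count f (j * m)                  ≡⟨ cong (count f m +_) (count-periodic f m f-per j) ⟩
  count f m + j * count f m                    ∎

iverson-split : ∀ a b → iverson a ≡ iverson (a ∧ b) + iverson (a ∧ not b)
iverson-split true  true  = refl
iverson-split true  false = refl
iverson-split false _     = refl

count-split : ∀ (f g : ℕ → Bool) n → count f n ≡ count (λ k → f k ∧ g k) n + count (λ k → f k ∧ not (g k)) n
count-split f g zero = refl
count-split f g (suc n) rewrite count-split f g n | iverson-split (f (suc n)) (g (suc n)) =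
  interchange (count (λ k → f k ∧ g k) n) (count (λ k → f k ∧ not (g k)) n) _ _

count-pos : ∀ (f : ℕ → Bool) n → f 1 ≡ true → 0 < n → 0 < count f n
count-pos f (suc zero)    f1 _ rewrite f1 = ≤-refl
count-pos f (suc (suc n)) f1 _ = ≤-trans (count-pos f (suc n) f1 z<s) (m≤m+n _ _)

_∣ᵇ_ : ℕ → ℕ → Bool
d ∣ᵇ k = does (d ∣? k)

∣ᵇ-+ : ∀ d k → d ∣ᵇ (d + k) ≡ d ∣ᵇ k
∣ᵇ-+ d k = does-⇔ (mk⇔ (λ d∣d+k → ∣m+n∣m⇒∣n d∣d+k ∣-refl) (∣m∣n⇒∣m+n ∣-refl)) (d ∣? (d + k)) (d ∣? k)

count-∧-∣ᵇ-block : ∀ d (f : ℕ → Bool) → count (λ k → f k ∧ suc d ∣ᵇ k) (suc d) ≡ iverson (f (suc d))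
count-∧-∣ᵇ-block d f = begin
  count (λ k → f k ∧ suc d ∣ᵇ k) d + iverson (f (suc d) ∧ suc d ∣ᵇ suc d)
    ≡⟨ cong₂ _+_ (count-cong d below-d) (cong (iverson ∘ (f (suc d) ∧_)) (dec-true (suc d ∣? suc d) ∣-refl)) ⟩
  count (λ _ → false) d + iverson (f (suc d) ∧ true)
    ≡⟨ cong₂ _+_ (count-false d) (cong iverson (∧-identityʳ (f (suc d)))) ⟩
  iverson (f (suc d)) ∎
  where
  below-d : ∀ k → k < d → f (suc k) ∧ suc d ∣ᵇ suc k ≡ false
  below-d k k<d rewrite dec-false (suc d ∣? suc k) (λ d∣k → <⇒≱ (s≤s k<d) (∣⇒≤ d∣k)) = ∧-zeroʳ (f (suc k))

count-∧-∣ᵇ : ∀ d (f : ℕ → Bool) m → count (λ k → f k ∧ suc d ∣ᵇ k) (m * suc d) ≡ count (λ j → f (j * suc d)) m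
count-∧-∣ᵇ d f zero    = refl
count-∧-∣ᵇ d f (suc m) = begin
  count (λ k → f k ∧ D ∣ᵇ k) (D + m * D)
    ≡⟨ count-+ (λ k → f k ∧ D ∣ᵇ k) D (m * D) ⟩
  count (λ k → f k ∧ D ∣ᵇ k) D + count (λ k → f (D + k) ∧ D ∣ᵇ (D + k)) (m * D)
    ≡⟨ cong₂ _+_ (count-∧-∣ᵇ-block d f) (count-cong (m * D) (λ k _ → cong (f (D + suc k) ∧_) (∣ᵇ-+ D (suc k)))) ⟩
  iverson (f D) + count (λ k → f (D + k) ∧ D ∣ᵇ k) (m * D)
    ≡⟨ cong₂ _+_ (cong (iverson ∘ f) (sym (+-identityʳ D))) (count-∧-∣ᵇ d (λ k → f (D + k)) m) ⟩
  iverson (f (D + 0)) + count (λ j → f (D + j * D)) m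
    ≡⟨ sym (count-+ (λ j → f (j * D)) 1 m) ⟩
  count (λ j → f (j * D)) (suc m) ∎
  where D = suc d

prime≢1 : ∀ {p} → Prime p → p ≢ 1
prime≢1 pp = nonTrivial⇒≢1 {{prime⇒nonTrivial pp}}

prime∣prime⇒≡ : ∀ {p q} → Prime p → Prime q → p ∣ q → p ≡ q
prime∣prime⇒≡ pp pq p∣q with prime⇒irreducible pq p∣q
... | inj₁ p≡1 = ⊥-elim (prime≢1 pp p≡1)
... | inj₂ p≡q = p≡q

prime-∣-^ : ∀ {p q} → Prime p → ∀ e → p ∣ q ^ e → p ∣ q
prime-∣-^ pp zero    p∣1 = ⊥-elim (prime≢1 pp (∣1⇒≡1 p∣1))
prime-∣-^ pp (suc e) p∣q^e+1 with euclidsLemma _ _ pp p∣q^e+1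
... | inj₁ p∣q   = p∣q
... | inj₂ p∣q^e = prime-∣-^ pp e p∣q^e

prime-∣-^*-⇔ : ∀ {p c} → Prime p → ¬ p ∣ c → ∀ t → p ∣ p ^ t * c ⇔ 0 < t
prime-∣-^*-⇔ pp p∤c zero    = mk⇔ (λ p∣c → ⊥-elim (p∤c (subst (_ ∣_) (*-identityˡ _) p∣c))) (λ ())
prime-∣-^*-⇔ pp p∤c (suc t) = mk⇔ (λ _ → z<s) (λ _ → ∣m⇒∣m*n _ (m∣m*n _))

prime∤⇒coprime : ∀ {p k} → Prime p → ¬ p ∣ k → Coprime k p
prime∤⇒coprime pp p∤k (d∣k , d∣p) with prime⇒irreducible pp d∣p
... | inj₁ d≡1 = d≡1
... | inj₂ refl = ⊥-elim (p∤k d∣k)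

coprime-∣ʳ : ∀ {a b c} → Coprime a b → c ∣ b → Coprime a c
coprime-∣ʳ a⊥b c∣b (d∣a , d∣c) = a⊥b (d∣a , ∣-trans d∣c c∣b)

coprime-∣ˡ : ∀ {a b c} → Coprime a b → c ∣ a → Coprime c b
coprime-∣ˡ a⊥b c∣a (d∣c , d∣b) = a⊥b (∣-trans d∣c c∣a , d∣b)

coprime-* : ∀ {a b c} → Coprime a b → Coprime a c → Coprime a (b * c)
coprime-* a⊥b a⊥c (d∣a , d∣bc) = a⊥c (d∣a , coprime-divisor (coprime-∣ˡ a⊥b d∣a) d∣bc)

coprime-+⇔ : ∀ m k → Coprime (m + k) m ⇔ Coprime k m
coprime-+⇔ m k = mk⇔ to from
  where
  to : Coprime (m + k) m → Coprime k m
  to m+k⊥m (d∣k , d∣m) = m+k⊥m (∣m∣n⇒∣m+n d∣m d∣k , d∣m)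
  from : Coprime k m → Coprime (m + k) m
  from k⊥m (d∣m+k , d∣m) = k⊥m (∣m+n∣m⇒∣n d∣m+k d∣m , d∣m)

coprime-*-∣⇔ : ∀ {p m} k → p ∣ m → Coprime k (p * m) ⇔ Coprime k m
coprime-*-∣⇔ {p} {m} k p∣m = mk⇔ to (λ k⊥m → coprime-* (coprime-∣ʳ k⊥m p∣m) k⊥m)
  where
  to : Coprime k (p * m) → Coprime k m
  to k⊥pm = coprime-∣ʳ k⊥pm (n∣m*n p)

coprime-*-prime⇔ : ∀ {p k} m → Prime p → ¬ p ∣ k → Coprime k (p * m) ⇔ Coprime k m
coprime-*-prime⇔ {p} {k} m pp p∤k = mk⇔ to (coprime-* (prime∤⇒coprime pp p∤k))
  where
  to : Coprime k (p * m) → Coprime k m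
  to k⊥pm = coprime-∣ʳ k⊥pm (n∣m*n p)

coprime-*ˡ-prime⇔ : ∀ {p m} j → Prime p → ¬ p ∣ m → Coprime (j * p) m ⇔ Coprime j m
coprime-*ˡ-prime⇔ {p} {m} j pp p∤m = mk⇔ to from
  where
  to : Coprime (j * p) m → Coprime j m
  to jp⊥m = coprime-∣ˡ jp⊥m (m∣m*n p)
  from : Coprime j m → Coprime (j * p) m
  from j⊥m = coprime-sym (coprime-* (coprime-sym j⊥m) (prime∤⇒coprime pp p∤m))

coprimeᵇ : ℕ → ℕ → Bool
coprimeᵇ k m = does (coprime? k m)

coprimeᵇ-+ : ∀ m k → coprimeᵇ (m + k) m ≡ coprimeᵇ k m
coprimeᵇ-+ m k = does-⇔ (coprime-+⇔ m k) (coprime? (m + k) m) (coprime? k m)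

coprimeᵇ-*-∣ : ∀ {p m} k → p ∣ m → coprimeᵇ k (p * m) ≡ coprimeᵇ k m
coprimeᵇ-*-∣ k p∣m = does-⇔ (coprime-*-∣⇔ k p∣m) (coprime? k _) (coprime? k _)

coprimeᵇ-*-prime : ∀ {p} m k → Prime p → coprimeᵇ k (p * m) ≡ coprimeᵇ k m ∧ not (p ∣ᵇ k)
coprimeᵇ-*-prime {p} m k pp with p ∣? k
... | yes p∣k = trans (dec-false (coprime? k (p * m)) (λ k⊥pm → prime≢1 pp (k⊥pm (p∣k , m∣m*n m))))
                      (sym (∧-zeroʳ _))
... | no  p∤k = trans (does-⇔ (coprime-*-prime⇔ m pp p∤k) (coprime? k (p * m)) (coprime? k m))
                      (sym (∧-identityʳ _))

coprimeᵇ-*ˡ : ∀ {p m} j → Prime p → ¬ p ∣ m → coprimeᵇ (j * p) m ≡ coprimeᵇ j m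
coprimeᵇ-*ˡ j pp p∤m = does-⇔ (coprime-*ˡ-prime⇔ j pp p∤m) (coprime? (j * _) _) (coprime? j _)

φ≡count-coprimeᵇ : ∀ n → φ n ≡ count (λ k → coprimeᵇ k n) n
φ≡count-coprimeᵇ n = trans (length-filter-upTo (λ k → gcd k n ≟ 1) n) (count-cong n (λ k _ →
  does-⇔ (mk⇔ gcd≡1⇒coprime coprime⇒gcd≡1) (gcd (suc k) n ≟ 1) (coprime? (suc k) n)))

φ>0 : ∀ {m} → 0 < m → 0 < φ m
φ>0 {m} m>0 = subst (0 <_) (sym (φ≡count-coprimeᵇ m))
  (count-pos _ m (dec-true (coprime? 1 m) (λ (d∣1 , _) → ∣1⇒≡1 d∣1)) m>0)

count-coprimeᵇ-multiple : ∀ m j → count (λ k → coprimeᵇ k m) (j * m) ≡ j * φ m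
count-coprimeᵇ-multiple m j = trans (count-periodic _ m (coprimeᵇ-+ m) j) (cong (j *_) (sym (φ≡count-coprimeᵇ m)))

φ-*-∣ : ∀ {p m} → p ∣ m → φ (p * m) ≡ p * φ m
φ-*-∣ {p} {m} p∣m = begin
  φ (p * m)                                    ≡⟨ φ≡count-coprimeᵇ (p * m) ⟩
  count (λ k → coprimeᵇ k (p * m)) (p * m)     ≡⟨ count-cong (p * m) (λ k _ → coprimeᵇ-*-∣ (suc k) p∣m) ⟩
  count (λ k → coprimeᵇ k m) (p * m)           ≡⟨ count-coprimeᵇ-multiple m p ⟩
  p * φ m                                      ∎

-- The numbers in [1, p m] coprime to m split into those prime to p, counted by
-- φ (p m), and the multiples j p with j coprime to m, counted by φ m.
φ-*-∤ : ∀ {p m} → Prime p → ¬ p ∣ m → φ (p * m) + φ m ≡ p * φ m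
φ-*-∤ {p@(suc d)} {m} pp p∤m = begin
  φ (p * m) + φ m
    ≡⟨ cong₂ _+_ (trans (φ≡count-coprimeᵇ (p * m)) (count-cong (p * m) (λ k _ → coprimeᵇ-*-prime m (suc k) pp)))
                 (sym multiples) ⟩
  count (λ k → c k ∧ not (p ∣ᵇ k)) (p * m) + count (λ k → c k ∧ p ∣ᵇ k) (p * m)
    ≡⟨ +-comm (count (λ k → c k ∧ not (p ∣ᵇ k)) (p * m)) _ ⟩
  count (λ k → c k ∧ p ∣ᵇ k) (p * m) + count (λ k → c k ∧ not (p ∣ᵇ k)) (p * m)
    ≡⟨ sym (count-split c (p ∣ᵇ_) (p * m)) ⟩
  count c (p * m)
    ≡⟨ count-coprimeᵇ-multiple m p ⟩
  p * φ m ∎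
  where
  c = λ k → coprimeᵇ k m
  multiples : count (λ k → c k ∧ p ∣ᵇ k) (p * m) ≡ φ m
  multiples = begin
    count (λ k → c k ∧ p ∣ᵇ k) (p * m)  ≡⟨ cong (count _) (*-comm p m) ⟩
    count (λ k → c k ∧ p ∣ᵇ k) (m * p)  ≡⟨ count-∧-∣ᵇ d c m ⟩
    count (λ j → c (j * p)) m           ≡⟨ count-cong m (λ j _ → coprimeᵇ-*ˡ (suc j) pp p∤m) ⟩
    count c m                           ≡⟨ φ≡count-coprimeᵇ m ⟨
    φ m                                 ∎

φ-^-*-∣ : ∀ {p m} → p ∣ m → ∀ t → φ (p ^ t * m) ≡ p ^ t * φ m
φ-^-*-∣ {p} {m} p∣m zero    = trans (cong φ (+-identityʳ m)) (sym (+-identityʳ (φ m)))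
φ-^-*-∣ {p} {m} p∣m (suc t) = begin
  φ (p * p ^ t * m)    ≡⟨ cong φ (*-assoc p (p ^ t) m) ⟩
  φ (p * (p ^ t * m))  ≡⟨ φ-*-∣ (∣n⇒∣m*n (p ^ t) p∣m) ⟩
  p * φ (p ^ t * m)    ≡⟨ cong (p *_) (φ-^-*-∣ p∣m t) ⟩
  p * (p ^ t * φ m)    ≡⟨ *-assoc p (p ^ t) (φ m) ⟨
  p * p ^ t * φ m      ∎

∤⇒>0 : ∀ {q m} → ¬ q ∣ m → 0 < m
∤⇒>0 {q} {zero}  q∤0 = contradiction (q ∣0) q∤0
∤⇒>0 {q} {suc m} _   = z<s

+-≡-*-compare : ∀ {a b c d y} → 0 < y → a + y ≡ c * y → b + y ≡ d * y →
  (c ≤ d → a ≤ b) × (a < b ⇔ c < d)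
+-≡-*-compare {a} {b} {c} {d} {y} y>0 a+y≡cy b+y≡dy =
    (λ c≤d → +-cancelʳ-≤ y a b (subst₂ _≤_ (sym a+y≡cy) (sym b+y≡dy) (*-monoˡ-≤ y c≤d)))
  , mk⇔ (λ a<b → *-cancelʳ-< y c d (subst₂ _<_ a+y≡cy b+y≡dy (+-monoˡ-< y a<b)))
        (λ c<d → +-cancelʳ-< y a b (subst₂ _<_ (sym a+y≡cy) (sym b+y≡dy) (*-monoˡ-< y {{>-nonZero y>0}} c<d)))

φ-*-prime-compare : ∀ {p q m} → Prime p → Prime q → p < q → ¬ q ∣ m →
  φ (p * m) ≤ φ (q * m) × ((φ (p * m) < φ (q * m)) ⇔ (¬ (p ∣ m × suc p ≡ q)))
φ-*-prime-compare {p} {q} {m} pp pq p<q q∤m with p ∣? m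
... | yes p∣m =
    proj₁ compared p<q
  , mk⇔ (λ lt (_ , 1+p≡q) → <-irrefl 1+p≡q (Equivalence.to (proj₂ compared) lt))
        (λ ¬X → Equivalence.from (proj₂ compared) (≤∧≢⇒< p<q (λ 1+p≡q → ¬X (p∣m , 1+p≡q))))
  where
  compared = +-≡-*-compare (φ>0 (∤⇒>0 q∤m)) (trans (cong (_+ φ m) (φ-*-∣ p∣m)) (+-comm (p * φ m) (φ m)))
                           (φ-*-∤ pq q∤m)
... | no p∤m =
    proj₁ compared (<⇒≤ p<q)
  , mk⇔ (λ _ (p∣m , _) → p∤m p∣m) (λ _ → Equivalence.from (proj₂ compared) p<q)
  where
  compared = +-≡-*-compare (φ>0 (∤⇒>0 q∤m)) (φ-*-∤ pp p∤m) (φ-*-∤ pq q∤m)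

φ-*-prime-compare-^ : ∀ {p q m} → Prime p → Prime q → p < q → ¬ q ∣ m → ∀ e → 0 < e →
  let lhs = φ (m * q ^ e)
      rhs = φ (p * m) * q ^ (e ∸ 1)
  in rhs ≤ lhs × ((rhs < lhs) ⇔ (¬ (p ∣ m × suc p ≡ q)))
φ-*-prime-compare-^ {p} {q} {m} pp pq p<q q∤m (suc t) _ =
  subst (λ lhs → φ (p * m) * q ^ t ≤ lhs × ((φ (p * m) * q ^ t < lhs) ⇔ _)) (sym lhs≡)
    ( *-monoˡ-≤ (q ^ t) (proj₁ compared)
    , mk⇔ (Equivalence.to (proj₂ compared) ∘ *-cancelʳ-< (q ^ t) _ _)
          (*-monoˡ-< (q ^ t) {{m^n≢0 q t {{prime⇒nonZero pq}}}} ∘ Equivalence.from (proj₂ compared)))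
  where
  compared = φ-*-prime-compare pp pq p<q q∤m
  lhs≡ : φ (m * q ^ suc t) ≡ φ (q * m) * q ^ t
  lhs≡ = begin
    φ (m * (q * q ^ t))    ≡⟨ cong φ (x∙yz≈z∙yx m q (q ^ t)) ⟩
    φ (q ^ t * (q * m))    ≡⟨ φ-^-*-∣ (m∣m*n m) t ⟩
    q ^ t * φ (q * m)      ≡⟨ *-comm (q ^ t) (φ (q * m)) ⟩
    φ (q * m) * q ^ t      ∎

∏-inject₁ : ∀ k (f : Fin (suc k) → ℕ) → ∏ (suc k) f ≡ ∏ k (f ∘ inject₁) * f (fromℕ k)
∏-inject₁ zero    f = trans (*-identityʳ (f fzero)) (sym (+-identityʳ (f fzero)))
∏-inject₁ (suc k) f = trans (cong (f fzero *_) (∏-inject₁ k (f ∘ fsuc))) (sym (*-assoc (f fzero) _ _))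

∏-punchIn : ∀ k (f : Fin (suc k) → ℕ) i → ∏ (suc k) f ≡ f i * ∏ k (f ∘ punchIn i)
∏-punchIn k       f fzero    = refl
∏-punchIn (suc k) f (fsuc i) = begin
  f fzero * ∏ (suc k) (f ∘ fsuc)                         ≡⟨ cong (f fzero *_) (∏-punchIn k (f ∘ fsuc) i) ⟩
  f fzero * (f (fsuc i) * ∏ k (f ∘ fsuc ∘ punchIn i))    ≡⟨ x∙yz≈y∙xz (f fzero) (f (fsuc i)) _ ⟩
  f (fsuc i) * (f fzero * ∏ k (f ∘ fsuc ∘ punchIn i))    ∎

prime-∤-∏ : ∀ k (f : Fin k → ℕ) {x} → Prime x → (∀ j → ¬ x ∣ f j) → ¬ x ∣ ∏ k f
prime-∤-∏ zero    f px x∤f x∣1 = prime≢1 px (∣1⇒≡1 x∣1)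
prime-∤-∏ (suc k) f px x∤f x∣∏ with euclidsLemma (f fzero) (∏ k (f ∘ fsuc)) px x∣∏
... | inj₁ x∣f0 = x∤f fzero x∣f0
... | inj₂ x∣∏′ = prime-∤-∏ k (f ∘ fsuc) px (x∤f ∘ fsuc) x∣∏′

prime-∤-∏-^ : ∀ k (q e : Fin k → ℕ) {x} → Prime x → (∀ j → Prime (q j)) → (∀ j → x ≢ q j) →
  ¬ x ∣ ∏ k (λ j → q j ^ e j)
prime-∤-∏-^ k q e px pq x≢q = prime-∤-∏ k _ px
  (λ j x∣q^e → x≢q j (prime∣prime⇒≡ px (pq j) (prime-∣-^ px (e j) x∣q^e)))

^-∸1 : ∀ p e → 0 < e → p ^ e ≡ p * p ^ (e ∸ 1)
^-∸1 p (suc e) _ = refl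

0<∸1⇔2≤ : ∀ n → (0 < n ∸ 1) ⇔ (2 ≤ n)
0<∸1⇔2≤ zero          = mk⇔ (λ ()) (λ ())
0<∸1⇔2≤ (suc zero)    = mk⇔ (λ ()) (λ { (s≤s ()) })
0<∸1⇔2≤ (suc (suc n)) = mk⇔ (λ _ → s≤s (s≤s z≤n)) (λ _ → z<s)

2∣n⊎2∣1+n : ∀ n → 2 ∣ n ⊎ 2 ∣ suc n
2∣n⊎2∣1+n zero = inj₁ (2 ∣0)
2∣n⊎2∣1+n (suc n) with 2∣n⊎2∣1+n n
... | inj₁ 2∣n   = inj₂ (∣m∣n⇒∣m+n (∣-refl {2}) 2∣n)
... | inj₂ 2∣1+n = inj₁ 2∣1+n

consecutive-primes : ∀ {p q} → Prime p → Prime q → (suc p ≡ q) ⇔ (p ≡ 2 × q ≡ 3)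
consecutive-primes {p} pp pq = mk⇔ to (λ { (refl , refl) → refl })
  where
  to : suc p ≡ _ → p ≡ 2 × _ ≡ 3
  to refl with 2∣n⊎2∣1+n p
  ... | inj₁ 2∣p   = let p≡2 = sym (prime∣prime⇒≡ prime[2] pp 2∣p) in p≡2 , cong suc p≡2
  ... | inj₂ 2∣1+p = ⊥-elim (prime≢1 pp (suc-injective (sym (prime∣prime⇒≡ prime[2] pq 2∣1+p))))

StrictlyIncreasing : ∀ {n} → (Fin n → ℕ) → Set
StrictlyIncreasing f = ∀ j j′ → toℕ j < toℕ j′ → f j < f j′

strictlyIncreasing⇒injective : ∀ {n} {f : Fin n → ℕ} → StrictlyIncreasing f → ∀ {j j′} → f j ≡ f j′ → j ≡ j′
strictlyIncreasing⇒injective f-inc {j} {j′} fj≡fj′ with <-cmp (toℕ j) (toℕ j′)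
... | tri< j<j′ _ _ = contradiction fj≡fj′ (<⇒≢ (f-inc j j′ j<j′))
... | tri≈ _ j≡j′ _ = toℕ-injective j≡j′
... | tri> _ _ j′<j = contradiction (sym fj≡fj′) (<⇒≢ (f-inc j′ j j′<j))

inject₁<fromℕ : ∀ {k} (j : Fin k) → toℕ (inject₁ j) < toℕ (fromℕ k)
inject₁<fromℕ {k} j = subst (toℕ (inject₁ j) <_) (sym (toℕ-fromℕ k)) (inject₁ℕ< j)

increasing-primes-last≡3 : ∀ k (p : Fin (suc (suc k)) → ℕ) → Prime (p fzero) → StrictlyIncreasing p →
  p (fromℕ (suc k)) ≡ 3 → k ≡ 0
increasing-primes-last≡3 zero    p p₀-prime p-inc pᵣ≡3 = refl
increasing-primes-last≡3 (suc k) p p₀-prime p-inc pᵣ≡3 = contradiction (subst (4 ≤_) pᵣ≡3 4≤pᵣ) (<-irrefl refl)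
  where
  4≤pᵣ : 4 ≤ p (fromℕ (suc (suc k)))
  4≤pᵣ = ≤-trans (s≤s (≤-trans (s≤s (nonTrivial⇒n>1 _ {{prime⇒nonTrivial p₀-prime}})) (p-inc fzero (fsuc fzero) z<s)))
                 (p-inc (fsuc fzero) (fromℕ (suc (suc k))) (s<s z<s))

-- B = pᵢ^(eᵢ − 1) · ∏_{j ≠ i, r} pⱼ^eⱼ
factorise : ∀ k (p e : Fin (suc (suc k)) → ℕ) → (∀ j → Prime (p j)) → StrictlyIncreasing p →
  (∀ j → 1 ≤ e j) → (i : Fin (suc k)) →
  let pᵢ = p (inject₁ i)
      pᵣ = p (fromℕ (suc k))
  in Σ ℕ λ B → ∏ (suc (suc k)) (λ j → p j ^ e j) ≡ pᵢ * B * pᵣ ^ e (fromℕ (suc k))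
             × ¬ pᵣ ∣ B × (pᵢ ∣ B ⇔ 2 ≤ e (inject₁ i))
factorise k p e prime p-inc pos i = B , ∏≡pᵢBpᵣ^eᵣ , pᵣ∤B , 0<∸1⇔2≤ (e ι) ⇔-∘ prime-∣-^*-⇔ (prime ι) pᵢ∤C (e ι ∸ 1)
  where
  ι = inject₁ i
  r = fromℕ (suc k)
  A = ∏ (suc k) (λ j → p (inject₁ j) ^ e (inject₁ j))
  C = ∏ k (λ j → p (inject₁ (punchIn i j)) ^ e (inject₁ (punchIn i j)))
  B = p ι ^ (e ι ∸ 1) * C

  A≡pᵢB : A ≡ p ι * B
  A≡pᵢB = begin
    A                           ≡⟨ ∏-punchIn k (λ j → p (inject₁ j) ^ e (inject₁ j)) i ⟩
    p ι ^ e ι * C               ≡⟨ cong (_* C) (^-∸1 (p ι) (e ι) (pos ι)) ⟩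
    p ι * p ι ^ (e ι ∸ 1) * C   ≡⟨ *-assoc (p ι) _ C ⟩
    p ι * B                     ∎

  ∏≡pᵢBpᵣ^eᵣ : ∏ (suc (suc k)) (λ j → p j ^ e j) ≡ p ι * B * p r ^ e r
  ∏≡pᵢBpᵣ^eᵣ = trans (∏-inject₁ (suc k) (λ j → p j ^ e j)) (cong (_* p r ^ e r) A≡pᵢB)

  pᵢ∤C : ¬ p ι ∣ C
  pᵢ∤C = prime-∤-∏-^ k (p ∘ inject₁ ∘ punchIn i) (e ∘ inject₁ ∘ punchIn i) (prime ι) (prime ∘ inject₁ ∘ punchIn i)
    (λ j pᵢ≡pⱼ → punchInᵢ≢i i j (sym (inject₁-injective (strictlyIncreasing⇒injective p-inc pᵢ≡pⱼ))))

  pᵣ∤A : ¬ p r ∣ A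
  pᵣ∤A = prime-∤-∏-^ (suc k) (p ∘ inject₁) (e ∘ inject₁) (prime r) (prime ∘ inject₁)
    (λ j pᵣ≡pⱼ → <⇒≢ (p-inc (inject₁ j) r (inject₁<fromℕ j)) (sym pᵣ≡pⱼ))

  pᵣ∤B : ¬ p r ∣ B
  pᵣ∤B pᵣ∣B = pᵣ∤A (subst (p r ∣_) (sym A≡pᵢB) (∣n⇒∣m*n (p ι) pᵣ∣B))

lemma2p1 : (k : ℕ) → 1 ≤ k →
    (p e : Fin (suc k) → ℕ) →
    (prime : (j : Fin (suc k)) → Prime (p j)) →
    (inc : (j j′ : Fin (suc k)) → toℕ j < toℕ j′ → p j < p j′) →
    (pos : (j : Fin (suc k)) → 1 ≤ e j) →
    (n : ℕ) → n ≡ ∏ (suc k) (λ j → p j ^ e j) →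
    (i : Fin k) →
      let pr = p (fromℕ k)
          er = e (fromℕ k)
          lhs = φ (divPrime n (p (inject₁ i)) (prime (inject₁ i)))
          rhs = φ (divPrimePow n pr er (prime (fromℕ k))) * pr ^ (er ∸ 1)
      in (rhs ≤ lhs)
         × ((rhs < lhs) ⇔ (¬ (k ≡ 1 × p (inject₁ i) ≡ 2 × pr ≡ 3 × e (inject₁ i) ≥ 2)))
lemma2p1 (suc k) _ p e prime p-inc pos n n≡∏ i with factorise k p e prime p-inc pos i
... | B , ∏≡pᵢBpᵣ^eᵣ , pᵣ∤B , pᵢ∣B⇔2≤eᵢ =
  subst₂ (λ rhs lhs → rhs ≤ lhs × ((rhs < lhs) ⇔ (¬ E))) (sym rhs≡) (sym lhs≡)
    ( proj₁ compared
    , mk⇔ (contraposition (Equivalence.from equality-case⇔E) ∘ Equivalence.to (proj₂ compared))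
          (Equivalence.from (proj₂ compared) ∘ contraposition (Equivalence.to equality-case⇔E)))
  where
  ι = inject₁ i
  r = fromℕ (suc k)
  E = suc k ≡ 1 × p ι ≡ 2 × p r ≡ 3 × e ι ≥ 2

  instance
    pᵢ≢0 : NonZero (p ι)
    pᵢ≢0 = prime⇒nonZero (prime ι)
    pᵣ^eᵣ≢0 : NonZero (p r ^ e r)
    pᵣ^eᵣ≢0 = m^n≢0 (p r) (e r) {{prime⇒nonZero (prime r)}}

  n≡pᵢBpᵣ^eᵣ : n ≡ p ι * B * p r ^ e r
  n≡pᵢBpᵣ^eᵣ = trans n≡∏ ∏≡pᵢBpᵣ^eᵣ

  lhs≡ : φ (divPrime n (p ι) (prime ι)) ≡ φ (B * p r ^ e r)
  lhs≡ = cong φ (begin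
    n / p ι                     ≡⟨ cong (_/ p ι) (trans n≡pᵢBpᵣ^eᵣ (xy∙z≈yz∙x (p ι) B (p r ^ e r))) ⟩
    B * p r ^ e r * p ι / p ι   ≡⟨ m*n/n≡m (B * p r ^ e r) (p ι) ⟩
    B * p r ^ e r               ∎)

  rhs≡ : φ (divPrimePow n (p r) (e r) (prime r)) * p r ^ (e r ∸ 1) ≡ φ (p ι * B) * p r ^ (e r ∸ 1)
  rhs≡ = cong (λ m → φ m * p r ^ (e r ∸ 1))
    (trans (cong (_/ p r ^ e r) n≡pᵢBpᵣ^eᵣ) (m*n/n≡m (p ι * B) (p r ^ e r)))

  compared = φ-*-prime-compare-^ (prime ι) (prime r) (p-inc ι r (inject₁<fromℕ i)) pᵣ∤B (e r) (pos r)

  equality-case⇔E : (p ι ∣ B × suc (p ι) ≡ p r) ⇔ E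
  equality-case⇔E = mk⇔ to from
    where
    to : p ι ∣ B × suc (p ι) ≡ p r → E
    to (pᵢ∣B , 1+pᵢ≡pᵣ) with Equivalence.to (consecutive-primes (prime ι) (prime r)) 1+pᵢ≡pᵣ
    ... | pᵢ≡2 , pᵣ≡3 = cong suc (increasing-primes-last≡3 k p (prime fzero) p-inc pᵣ≡3)
                      , pᵢ≡2 , pᵣ≡3 , Equivalence.to pᵢ∣B⇔2≤eᵢ pᵢ∣B
    from : E → p ι ∣ B × suc (p ι) ≡ p r
    from (_ , pᵢ≡2 , pᵣ≡3 , 2≤eᵢ) = Equivalence.from pᵢ∣B⇔2≤eᵢ 2≤eᵢ
                                 , Equivalence.from (consecutive-primes (prime ι) (prime r)) (pᵢ≡2 , pᵣ≡3)
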